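{- For $s,t\in\mu_r$ and $v,w\in\mathcal{A}_r$, \[ y\diamond_s vz_t^{\delta}w=(y\diamond_s v)z_t^{\delta}w+vz_t^{\delta}(y\diamond_s w)+vz_t^{\delta}(z_s^{\delta}-z_t^{\delta})w. \]
   Context: Let $r\ge1$, $\mu_r$ the $r$-th roots of unity, $\mathcal{A}_r=\mathbb{Q}\langle x,y_s\mid s\in\mu_r\rangle$, $y=y_1$, $z=x+y_1$, $z_t=x+y_t$, $z_s^{\delta}=x+\delta(s)y_s$ with $\delta(1)=0$, $\delta(s)=1$ for $s\ne1$, $z_{k,s}=x^{k-1}y_s$, $\mathcal{A}_1=\mathbb{Q}\langle x,y\rangle\subset\mathcal{A}_r$. $\varphi$: automorphism of $\mathcal{A}_r$ with $\varphi(x)=z$, $\varphi(y_s)=\delta(s)y_s-y_1$. $\mathcal{I}(z_{k_1,s_1}\cdots z_{k_l,s_l}x^a)=z_{k_1,s_1}z_{k_2,s_1s_2}\cdots z_{k_l,s_1\cdots s_l}x^a$, $M_s(z_{k_1,s_1}\cdots z_{k_l,s_l}x^a)=z_{k_1,ss_1}z_{k_2,s_2}\cdots z_{k_l,s_l}x^a$ (linear, $a\ge0$), $\psi_s=\varphi\mathcal{I}M_s$. Diamond product $\diamond_s:\mathcal{A}_1\times\mathcal{A}_r\to\mathcal{A}_r$ ($s\in\mu_r$): $\mathbb{Q}$-bilinear, defined recursively for words $v\in\mathcal{A}_1,w\in\mathcal{A}_r$, $1\ne t\in\mu_r$ by $1\diamond_s w=w$, $v\diamond_s1=\psi_s\varphi(v)$,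 $vx\diamond_s wx=(v\diamond_s wx)x-(vy\diamond_s w)x$, $vy\diamond_s wx=(v\diamond_s wx)y+(vy\diamond_s w)x$, $vx\diamond_s wy=(v\diamond_s wy)x+(vx\diamond_s w)y$, $vy\diamond_s wy=(v\diamond_s wy)y-(vx\diamond_s w)y$, $vx\diamond_s wy_t=(v\diamond_s wy_t)x+(v\diamond_s wz_t)y_t-(vy\diamond_s w)y_t$, $vy\diamond_s wy_t=(v\diamond_s wy_t)y-(v\diamond_s wz_t)y_t+(vy\diamond_s w)y_t$. -}

module Defs where

open import Data.Nat using (ℕ; zero; suc; _%_)
import Data.Nat as ℕ
open import Data.Nat.DivMod using (m%n<n)
open import Data.Fin using (Fin; zero; suc; toℕ; fromℕ<)
import Data.Fin.Properties as FinP
open import Data.List using (List; []; _∷_; _++_; map; concatMap; reverse; foldr)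
import Data.List.Properties as ListP
open import Data.Product using (_×_; _,_)
open import Data.Rational using (ℚ; 0ℚ; 1ℚ; _+_; _*_; -_)
open import Relation.Binary.PropositionalEquality using (_≡_; refl; cong)
open import Relation.Nullary using (Dec; yes; no)
open import Relation.Binary.Definitions using (DecidableEquality)

-- We fix r = suc n (so r ≥ 1).  The group μ_r of r-th
-- roots of unity is represented by exponents: the index i : Fin r stands
-- for ζ^i with ζ = exp(2πi/r).  Hence 1 ∈ μ_r is 'zero' and the product
-- of roots of unity is addition of exponents modulo r.

μ : ℕ → Set
μ n = Fin (suc n)

_·μ_ : {n : ℕ} → μ n → μ n → μ n
_·μ_ {n} i j = fromℕ< (m%n<n (toℕ i ℕ.+ toℕ j) (suc n))

δ : {n : ℕ} → μ n → ℚ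
δ zero    = 0ℚ
δ (suc _) = 1ℚ

data Letter (n : ℕ) : Set where
  𝕩 : Letter n
  𝕪 : μ n → Letter n

Word : ℕ → Set
Word n = List (Letter n)

-- A noncommutative polynomial is a finite formal ℚ-linear combination of
-- words; two polynomials are equal when all their coefficients agree.
Poly : ℕ → Set
Poly n = List (ℚ × Word n)

module _ {n : ℕ} where

  letter-≟ : DecidableEquality (Letter n)
  letter-≟ 𝕩 𝕩 = yes refl
  letter-≟ 𝕩 (𝕪 _) = no (λ ())
  letter-≟ (𝕪 _) 𝕩 = no (λ ())
  letter-≟ (𝕪 i) (𝕪 j) with i FinP.≟ j
  ... | yes refl = yes refl
  ... | no i≢j = no (λ { refl → i≢j refl })

  word-≟ : DecidableEquality (Word n)
  word-≟ = ListP.≡-dec letter-≟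

  coeff : Poly n → Word n → ℚ
  coeff [] u = 0ℚ
  coeff ((c , w) ∷ p) u with word-≟ w u
  ... | yes _ = c + coeff p u
  ... | no _  = coeff p u

  _≈_ : Poly n → Poly n → Set
  p ≈ q = ∀ u → coeff p u ≡ coeff q u

  infix 4 _≈_
  infixl 6 _⊕_ _⊖_
  infixl 7 _⊗_

  𝟘 : Poly n
  𝟘 = []

  𝟙 : Poly n
  𝟙 = (1ℚ , []) ∷ []

  mono : Word n → Poly n
  mono w = (1ℚ , w) ∷ []

  lt : Letter n → Poly n
  lt a = mono (a ∷ [])

  scale : ℚ → Poly n → Poly n
  scale c = map (λ { (d , w) → (c * d , w) })

  _⊕_ : Poly n → Poly n → Poly n
  p ⊕ q = p ++ q

  ⊝_ : Poly n → Poly n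
  ⊝ p = scale (- 1ℚ) p

  _⊖_ : Poly n → Poly n → Poly n
  p ⊖ q = p ⊕ (⊝ q)

  _⊗_ : Poly n → Poly n → Poly n
  p ⊗ q = concatMap (λ { (c , u) → map (λ { (d , w) → (c * d , u ++ w) }) q }) p

  linext : (Word n → Poly n) → Poly n → Poly n
  linext f = concatMap (λ { (c , w) → scale c (f w) })

  xP : Poly n
  xP = lt 𝕩

  yP : Poly n
  yP = lt (𝕪 zero)

  z : Poly n
  z = xP ⊕ yP

  zδ : μ n → Poly n
  zδ s = xP ⊕ scale (δ s) (lt (𝕪 s))

  φL : Letter n → Poly n
  φL 𝕩 = z
  φL (𝕪 s) = scale (δ s) (lt (𝕪 s)) ⊖ yP

  φW : Word n → Poly n
  φW = foldr (λ a p → φL a ⊗ p) 𝟙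

  φ : Poly n → Poly n
  φ = linext φW

  -- 𝓘 : z_{k1,s1} ⋯ z_{kl,sl} x^a ↦ z_{k1,s1} z_{k2,s1s2} ⋯ z_{kl,s1⋯sl} x^a
  𝓘acc : μ n → Word n → Word n
  𝓘acc acc [] = []
  𝓘acc acc (𝕩 ∷ w) = 𝕩 ∷ 𝓘acc acc w
  𝓘acc acc (𝕪 s ∷ w) = 𝕪 (acc ·μ s) ∷ 𝓘acc (acc ·μ s) w

  𝓘 : Poly n → Poly n
  𝓘 = linext (λ w → mono (𝓘acc zero w))

  -- M_s : z_{k1,s1} ⋯ ↦ z_{k1,s s1} z_{k2,s2} ⋯
  MW : μ n → Word n → Word n
  MW s [] = []
  MW s (𝕩 ∷ w) = 𝕩 ∷ MW s w
  MW s (𝕪 u ∷ w) = 𝕪 (s ·μ u) ∷ w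

  M : μ n → Poly n → Poly n
  M s = linext (λ w → mono (MW s w))

  ψ : μ n → Poly n → Poly n
  ψ s p = φ (𝓘 (M s p))

data Letter₁ : Set where
  X Y : Letter₁

Word₁ : Set
Word₁ = List Letter₁

ι : {n : ℕ} → Letter₁ → Letter n
ι X = 𝕩
ι Y = 𝕪 zero

-- The diamond product ⋄_s on words.  Internally both words are stored
-- reversed (head = last letter), so that the recursion peels off the
-- last letters as in the defining relations.

module Diamond {n : ℕ} (s : μ n) where

  _·ℓ_ : Poly n → Letter n → Poly n
  p ·ℓ a = p ⊗ lt a

  mutual
    -- dR v w = rev(v) ⋄_s rev(w)
    dR : Word₁ → Word n → Poly n
    dR [] w = mono (reverse w)
    dR (a ∷ v) w = dL a v w

    -- dL a v w = (rev(v) a) ⋄_s rev(w)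
    dL : Letter₁ → Word₁ → Word n → Poly n
    dL a v [] = ψ s (φ (mono (map ι (reverse (a ∷ v)))))
    dL X v (𝕩 ∷ w) = (dR v (𝕩 ∷ w) ·ℓ 𝕩) ⊖ (dL Y v w ·ℓ 𝕩)
    dL Y v (𝕩 ∷ w) = (dR v (𝕩 ∷ w) ·ℓ 𝕪 zero) ⊕ (dL Y v w ·ℓ 𝕩)
    dL X v (𝕪 zero ∷ w) = (dR v (𝕪 zero ∷ w) ·ℓ 𝕩) ⊕ (dL X v w ·ℓ 𝕪 zero)
    dL Y v (𝕪 zero ∷ w) = (dR v (𝕪 zero ∷ w) ·ℓ 𝕪 zero) ⊖ (dL X v w ·ℓ 𝕪 zero)
    -- vx ⋄ wy_t,  vy ⋄ wy_t   (t ≠ 1);  v ⋄ wz_t = v ⋄ wx + v ⋄ wy_t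
    dL X v (𝕪 (suc k) ∷ w) =
      (dR v (𝕪 (suc k) ∷ w) ·ℓ 𝕩)
      ⊕ ((dR v (𝕩 ∷ w) ⊕ dR v (𝕪 (suc k) ∷ w)) ·ℓ 𝕪 (suc k))
      ⊖ (dL Y v w ·ℓ 𝕪 (suc k))
    dL Y v (𝕪 (suc k) ∷ w) =
      (dR v (𝕪 (suc k) ∷ w) ·ℓ 𝕪 zero)
      ⊖ ((dR v (𝕩 ∷ w) ⊕ dR v (𝕪 (suc k) ∷ w)) ·ℓ 𝕪 (suc k))
      ⊕ (dL Y v w ·ℓ 𝕪 (suc k))

_⋄[_]_ : {n : ℕ} → Word₁ → μ n → Poly n → Poly n
v ⋄[ s ] p = linext (λ w → Diamond.dR s (reverse v) (reverse w)) p

infixl 8 _⋄[_]_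

-- A polynomial is determined by its pairings ⟪ p , h ⟫ = Σ c · h(w) with
-- all functions h on words, and both sides of the identity are linear in
-- v and in w; so it suffices to pair both sides with an arbitrary h and
-- expand v and w into words a and b.  On words, y ⋄_s obeys a Leibniz
-- rule whose defect depends only on the inserted letter c:
--   y ⋄ (a c b) = (y ⋄ a) c b + a c (y ⋄ b) + a ε(c) b,
--   ε(c) = κ(c) − c (y ⋄ 1),  y ⋄ 1 = y − δ(s) y_s.
-- It follows by induction on b from y ⋄ (w c) = (y ⋄ w) c + w κ(c), where
-- κ(c) is read off the defining recursion (for c = y after eliminating
-- x ⋄ w through (x + y) ⋄ w = w (x + y)).  Extended linearly,
-- ε(z_t^δ) = z_t^δ (z_s^δ − z_t^δ), which is the lemma.

module Submission where

open import Data.Fin using (zero; suc; toℕ)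
open import Data.Fin.Properties using (toℕ-injective; toℕ-fromℕ<; toℕ<n)
open import Data.List using ([]; _∷_; _++_; _∷ʳ_; map; concatMap; reverse)
open import Data.List.Properties using (++-assoc; ++-identityʳ; reverse-++; reverse-involutive; unfold-reverse)
open import Data.List.Reverse using (Reverse; []; _∶_∶ʳ_; reverseView)
open import Data.Nat using (ℕ; _%_)
import Data.Nat as ℕ
import Data.Nat.Properties as ℕₚ
open import Data.Nat.DivMod using (m<n⇒m%n≡m)
open import Data.Product using (_×_; _,_)
open import Data.Rational using (ℚ; 0ℚ; 1ℚ; _+_; _*_; -_; _-_)
import Data.Rational.Properties as ℚ
open import Function using (_∘_)
open import Relation.Binary.PropositionalEquality
open import Relation.Nullary using (yes; no)
open import Relation.Nullary.Decidable.Core using (dec⇒maybe)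
open import Tactic.RingSolver using (solve-∀)
open import Tactic.RingSolver.Core.AlmostCommutativeRing using (AlmostCommutativeRing; fromCommutativeRing)

open import Defs

open ≡-Reasoning

ℚring : AlmostCommutativeRing _ _
ℚring = fromCommutativeRing ℚ.+-*-commutativeRing (λ q → dec⇒maybe (0ℚ ℚ.≟ q))

pattern 𝕪₁ = 𝕪 zero

·μ-identityˡ : ∀ {n} (i : μ n) → zero ·μ i ≡ i
·μ-identityˡ i = toℕ-injective (trans (toℕ-fromℕ< _) (m<n⇒m%n≡m (toℕ<n i)))

·μ-identityʳ : ∀ {n} (i : μ n) → i ·μ zero ≡ i
·μ-identityʳ {n} i = toℕ-injective (begin
  toℕ (i ·μ zero)          ≡⟨ toℕ-fromℕ< _ ⟩
  (toℕ i ℕ.+ 0) % ℕ.suc n  ≡⟨ cong (_% ℕ.suc n) (ℕₚ.+-identityʳ (toℕ i)) ⟩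
  toℕ i % ℕ.suc n          ≡⟨ m<n⇒m%n≡m (toℕ<n i) ⟩
  toℕ i                    ∎)

module _ {n : ℕ} where

  ⟪_,_⟫ : Poly n → (Word n → ℚ) → ℚ
  ⟪ [] , h ⟫ = 0ℚ
  ⟪ (c , w) ∷ p , h ⟫ = c * h w + ⟪ p , h ⟫

  ⟪⟫-⊕ : ∀ (p q : Poly n) h → ⟪ p ⊕ q , h ⟫ ≡ ⟪ p , h ⟫ + ⟪ q , h ⟫
  ⟪⟫-⊕ [] q h = sym (ℚ.+-identityˡ _)
  ⟪⟫-⊕ ((c , w) ∷ p) q h =
    trans (cong (c * h w +_) (⟪⟫-⊕ p q h)) (sym (ℚ.+-assoc (c * h w) _ _))

  ⟪⟫-⊕₃ : ∀ (p q r : Poly n) h → ⟪ p ⊕ q ⊕ r , h ⟫ ≡ ⟪ p , h ⟫ + ⟪ q , h ⟫ + ⟪ r , h ⟫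
  ⟪⟫-⊕₃ p q r h = trans (⟪⟫-⊕ (p ⊕ q) r h) (cong (_+ ⟪ r , h ⟫) (⟪⟫-⊕ p q h))

  ⟪⟫-cong : ∀ (p : Poly n) {h g} → (∀ w → h w ≡ g w) → ⟪ p , h ⟫ ≡ ⟪ p , g ⟫
  ⟪⟫-cong [] eq = refl
  ⟪⟫-cong ((c , w) ∷ p) eq = cong₂ (λ a b → c * a + b) (eq w) (⟪⟫-cong p eq)

  ⟪⟫-+ : ∀ (p : Poly n) h g → ⟪ p , (λ w → h w + g w) ⟫ ≡ ⟪ p , h ⟫ + ⟪ p , g ⟫
  ⟪⟫-+ [] h g = refl
  ⟪⟫-+ ((c , w) ∷ p) h g =
    trans (cong (c * (h w + g w) +_) (⟪⟫-+ p h g)) (ring c (h w) (g w) _ _)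
    where
    ring : ∀ c x y a b → c * (x + y) + (a + b) ≡ (c * x + a) + (c * y + b)
    ring = solve-∀ ℚring

  ⟪⟫-* : ∀ (p : Poly n) k h → ⟪ p , (λ w → k * h w) ⟫ ≡ k * ⟪ p , h ⟫
  ⟪⟫-* [] k h = sym (ℚ.*-zeroʳ k)
  ⟪⟫-* ((c , w) ∷ p) k h =
    trans (cong (c * (k * h w) +_) (⟪⟫-* p k h)) (ring k c (h w) _)
    where
    ring : ∀ k c x a → c * (k * x) + k * a ≡ k * (c * x + a)
    ring = solve-∀ ℚring

  ⟪⟫-0 : ∀ (p : Poly n) → ⟪ p , (λ _ → 0ℚ) ⟫ ≡ 0ℚ
  ⟪⟫-0 [] = refl
  ⟪⟫-0 ((c , w) ∷ p) =
    trans (cong (c * 0ℚ +_) (⟪⟫-0 p)) (trans (ℚ.+-identityʳ _) (ℚ.*-zeroʳ c))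

  ⟪⟫-swap : ∀ (p q : Poly n) (f : Word n → Word n → ℚ) →
    ⟪ p , (λ a → ⟪ q , f a ⟫) ⟫ ≡ ⟪ q , (λ b → ⟪ p , (λ a → f a b) ⟫) ⟫
  ⟪⟫-swap [] q f = sym (⟪⟫-0 q)
  ⟪⟫-swap ((c , a) ∷ p) q f =
    trans (cong₂ _+_ (sym (⟪⟫-* q c (f a))) (⟪⟫-swap p q f))
          (sym (⟪⟫-+ q (λ b → c * f a b) (λ b → ⟪ p , (λ a′ → f a′ b) ⟫)))

  -- Stated for any F agreeing with the multiplication map, because the
  -- pattern lambdas inside the definitions of _⊗_ and scale are not
  -- definitionally equal to one written here.
  ⟪⟫-map : ∀ (F : ℚ × Word n → ℚ × Word n) c u (q : Poly n) h →
    (∀ d w → F (d , w) ≡ (c * d , u ++ w)) →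
    ⟪ map F q , h ⟫ ≡ c * ⟪ q , (λ w → h (u ++ w)) ⟫
  ⟪⟫-map F c u [] h eq = sym (ℚ.*-zeroʳ c)
  ⟪⟫-map F c u ((d , w) ∷ q) h eq rewrite eq d w =
    trans (cong ((c * d) * h (u ++ w) +_) (⟪⟫-map F c u q h eq)) (ring c d _ _)
    where
    ring : ∀ c d x a → (c * d) * x + c * a ≡ c * (d * x + a)
    ring = solve-∀ ℚring

  ⟪⟫-concatMap : ∀ (F : ℚ × Word n → Poly n) (p : Poly n) h (g : Word n → ℚ) →
    (∀ c w → ⟪ F (c , w) , h ⟫ ≡ c * g w) →
    ⟪ concatMap F p , h ⟫ ≡ ⟪ p , g ⟫
  ⟪⟫-concatMap F [] h g eq = refl
  ⟪⟫-concatMap F ((c , w) ∷ p) h g eq =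
    trans (⟪⟫-⊕ (F (c , w)) (concatMap F p) h) (cong₂ _+_ (eq c w) (⟪⟫-concatMap F p h g eq))

  ⟪⟫-⊗ : ∀ (p q : Poly n) h → ⟪ p ⊗ q , h ⟫ ≡ ⟪ p , (λ a → ⟪ q , (λ b → h (a ++ b)) ⟫) ⟫
  ⟪⟫-⊗ p q h = ⟪⟫-concatMap _ p h _ (λ c a → ⟪⟫-map _ c a q h (λ d w → refl))

  ⟪⟫-scale : ∀ c (p : Poly n) h → ⟪ scale c p , h ⟫ ≡ c * ⟪ p , h ⟫
  ⟪⟫-scale c p h = ⟪⟫-map _ c [] p h (λ d w → refl)

  ⟪⟫-linext : ∀ (f : Word n → Poly n) (p : Poly n) h →
    ⟪ linext f p , h ⟫ ≡ ⟪ p , (λ a → ⟪ f a , h ⟫) ⟫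
  ⟪⟫-linext f p h = ⟪⟫-concatMap _ p h _ (λ c a → ⟪⟫-scale c (f a) h)

  ⟪⟫-⊖ : ∀ (p q : Poly n) h → ⟪ p ⊖ q , h ⟫ ≡ ⟪ p , h ⟫ - ⟪ q , h ⟫
  ⟪⟫-⊖ p q h = trans (⟪⟫-⊕ p (⊝ q) h) (trans (cong (⟪ p , h ⟫ +_) (⟪⟫-scale (- 1ℚ) q h)) (ring ⟪ p , h ⟫ ⟪ q , h ⟫))
    where
    ring : ∀ a b → a + (- 1ℚ) * b ≡ a - b
    ring = solve-∀ ℚring

  ⟪⟫-mono : ∀ (u : Word n) h → ⟪ mono u , h ⟫ ≡ h u
  ⟪⟫-mono u h = trans (ℚ.+-identityʳ _) (ℚ.*-identityˡ (h u))

  ⟪⟫-mono⊕mono : ∀ (u u′ : Word n) h → ⟪ mono u ⊕ mono u′ , h ⟫ ≡ h u + h u′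
  ⟪⟫-mono⊕mono u u′ h = trans (⟪⟫-⊕ (mono u) (mono u′) h) (cong₂ _+_ (⟪⟫-mono u h) (⟪⟫-mono u′ h))

  ⟪⟫-⊗lt : ∀ (p : Poly n) a h → ⟪ p ⊗ lt a , h ⟫ ≡ ⟪ p , h ∘ (_∷ʳ a) ⟫
  ⟪⟫-⊗lt p a h = trans (⟪⟫-⊗ p (lt a) h) (⟪⟫-cong p (λ w → ⟪⟫-mono (a ∷ []) (h ∘ (w ++_))))

  ⟪⟫-lt⊗ : ∀ a (p : Poly n) h → ⟪ lt a ⊗ p , h ⟫ ≡ ⟪ p , h ∘ (a ∷_) ⟫
  ⟪⟫-lt⊗ a p h = trans (⟪⟫-⊗ (lt a) p h) (⟪⟫-mono (a ∷ []) (λ a′ → ⟪ p , (λ b → h (a′ ++ b)) ⟫))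

  ⟪⟫-mono⊗lt : ∀ (u : Word n) a h → ⟪ mono u ⊗ lt a , h ⟫ ≡ h (u ∷ʳ a)
  ⟪⟫-mono⊗lt u a h = trans (⟪⟫-⊗lt (mono u) a h) (⟪⟫-mono u (h ∘ (_∷ʳ a)))

  ⟪⟫-zδ : ∀ t (f : Word n → ℚ) → ⟪ zδ t , f ⟫ ≡ f (𝕩 ∷ []) + δ t * f (𝕪 t ∷ [])
  ⟪⟫-zδ t f = ring (δ t) (f (𝕩 ∷ [])) (f (𝕪 t ∷ []))
    where
    ring : ∀ d a b → 1ℚ * a + ((d * 1ℚ) * b + 0ℚ) ≡ a + d * b
    ring = solve-∀ ℚring

  ⟪⟫-⊗-assoc : ∀ (p q r : Poly n) h → ⟪ p ⊗ q ⊗ r , h ⟫ ≡ ⟪ p ⊗ (q ⊗ r) , h ⟫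
  ⟪⟫-⊗-assoc p q r h = begin
    ⟪ p ⊗ q ⊗ r , h ⟫
      ≡⟨ ⟪⟫-⊗ (p ⊗ q) r h ⟩
    ⟪ p ⊗ q , (λ c → ⟪ r , (λ b → h (c ++ b)) ⟫) ⟫
      ≡⟨ ⟪⟫-⊗ p q _ ⟩
    ⟪ p , (λ a → ⟪ q , (λ m → ⟪ r , (λ b → h ((a ++ m) ++ b)) ⟫) ⟫) ⟫
      ≡⟨ ⟪⟫-cong p (λ a → ⟪⟫-cong q (λ m → ⟪⟫-cong r (λ b → cong h (++-assoc a m b)))) ⟩
    ⟪ p , (λ a → ⟪ q , (λ m → ⟪ r , (λ b → h (a ++ m ++ b)) ⟫) ⟫) ⟫
      ≡⟨ ⟪⟫-cong p (λ a → sym (⟪⟫-⊗ q r (h ∘ (a ++_)))) ⟩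
    ⟪ p , (λ a → ⟪ q ⊗ r , (λ c → h (a ++ c)) ⟫) ⟫
      ≡⟨ sym (⟪⟫-⊗ p (q ⊗ r) h) ⟩
    ⟪ p ⊗ (q ⊗ r) , h ⟫ ∎

  ⟪⟫-sandwich : ∀ (p q r : Poly n) h →
    ⟪ p ⊗ q ⊗ r , h ⟫ ≡ ⟪ p , (λ a → ⟪ r , (λ b → ⟪ q , (λ m → h (a ++ m ++ b)) ⟫) ⟫) ⟫
  ⟪⟫-sandwich p q r h = begin
    ⟪ p ⊗ q ⊗ r , h ⟫
      ≡⟨ ⟪⟫-⊗-assoc p q r h ⟩
    ⟪ p ⊗ (q ⊗ r) , h ⟫
      ≡⟨ ⟪⟫-⊗ p (q ⊗ r) h ⟩
    ⟪ p , (λ a → ⟪ q ⊗ r , (λ c → h (a ++ c)) ⟫) ⟫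
      ≡⟨ ⟪⟫-cong p (λ a → trans (⟪⟫-⊗ q r _) (⟪⟫-swap q r _)) ⟩
    ⟪ p , (λ a → ⟪ r , (λ b → ⟪ q , (λ m → h (a ++ m ++ b)) ⟫) ⟫) ⟫ ∎

  ⟪⟫-linext-sandwich : ∀ (f : Word n → Poly n) (p q r : Poly n) h →
    ⟪ linext f (p ⊗ q ⊗ r) , h ⟫
    ≡ ⟪ p , (λ a → ⟪ r , (λ b → ⟪ q , (λ m → ⟪ f (a ++ m ++ b) , h ⟫) ⟫) ⟫) ⟫
  ⟪⟫-linext-sandwich f p q r h =
    trans (⟪⟫-linext f (p ⊗ q ⊗ r) h) (⟪⟫-sandwich p q r (λ c → ⟪ f c , h ⟫))

  ⟪⟫-linext⊗⊗ : ∀ (f : Word n → Poly n) (p q r : Poly n) h →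
    ⟪ linext f p ⊗ q ⊗ r , h ⟫
    ≡ ⟪ p , (λ a → ⟪ r , (λ b → ⟪ q , (λ m → ⟪ f a , (λ u → h (u ++ m ++ b)) ⟫) ⟫) ⟫) ⟫
  ⟪⟫-linext⊗⊗ f p q r h = begin
    ⟪ linext f p ⊗ q ⊗ r , h ⟫
      ≡⟨ ⟪⟫-sandwich (linext f p) q r h ⟩
    ⟪ linext f p , (λ a′ → ⟪ r , H a′ ⟫) ⟫
      ≡⟨ ⟪⟫-linext f p (λ a′ → ⟪ r , H a′ ⟫) ⟩
    ⟪ p , (λ a → ⟪ f a , (λ a′ → ⟪ r , H a′ ⟫) ⟫) ⟫
      ≡⟨ ⟪⟫-cong p (λ a → trans (⟪⟫-swap (f a) r H)
                                (⟪⟫-cong r (λ b → ⟪⟫-swap (f a) q (λ a′ m → h (a′ ++ m ++ b))))) ⟩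
    ⟪ p , (λ a → ⟪ r , (λ b → ⟪ q , (λ m → ⟪ f a , (λ u → h (u ++ m ++ b)) ⟫) ⟫) ⟫) ⟫ ∎
    where
    H : Word n → Word n → ℚ
    H a′ b = ⟪ q , (λ m → h (a′ ++ m ++ b)) ⟫

  ⟪⟫-⊗⊗linext : ∀ (f : Word n → Poly n) (p q r : Poly n) h →
    ⟪ p ⊗ q ⊗ linext f r , h ⟫
    ≡ ⟪ p , (λ a → ⟪ r , (λ b → ⟪ q , (λ m → ⟪ f b , (λ u → h (a ++ m ++ u)) ⟫) ⟫) ⟫) ⟫
  ⟪⟫-⊗⊗linext f p q r h =
    trans (⟪⟫-sandwich p q (linext f r) h)
          (⟪⟫-cong p (λ a → trans (⟪⟫-linext f r (λ b′ → ⟪ q , (λ m → h (a ++ m ++ b′)) ⟫))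
                                  (⟪⟫-cong r (λ b → ⟪⟫-swap (f b) q (λ b′ m → h (a ++ m ++ b′))))))

  ⟪⟫-⊗⊗⊗ : ∀ (p q q′ r : Poly n) h →
    ⟪ p ⊗ q ⊗ q′ ⊗ r , h ⟫ ≡ ⟪ p , (λ a → ⟪ r , (λ b → ⟪ q ⊗ q′ , (λ m → h (a ++ m ++ b)) ⟫) ⟫) ⟫
  ⟪⟫-⊗⊗⊗ p q q′ r h = begin
    ⟪ p ⊗ q ⊗ q′ ⊗ r , h ⟫      ≡⟨ ⟪⟫-⊗ (p ⊗ q ⊗ q′) r h ⟩
    ⟪ p ⊗ q ⊗ q′ , h′ ⟫         ≡⟨ ⟪⟫-⊗-assoc p q q′ h′ ⟩
    ⟪ p ⊗ (q ⊗ q′) , h′ ⟫       ≡⟨ sym (⟪⟫-⊗ (p ⊗ (q ⊗ q′)) r h) ⟩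
    ⟪ p ⊗ (q ⊗ q′) ⊗ r , h ⟫    ≡⟨ ⟪⟫-sandwich p (q ⊗ q′) r h ⟩
    ⟪ p , (λ a → ⟪ r , (λ b → ⟪ q ⊗ q′ , (λ m → h (a ++ m ++ b)) ⟫) ⟫) ⟫ ∎
    where
    h′ : Word n → ℚ
    h′ c = ⟪ r , (λ b → h (c ++ b)) ⟫

  ⟪⟫-cong∘ : ∀ (p : Poly n) h {f g : Word n → Word n} → (∀ u → f u ≡ g u) → ⟪ p , h ∘ f ⟫ ≡ ⟪ p , h ∘ g ⟫
  ⟪⟫-cong∘ p h eq = ⟪⟫-cong p (cong h ∘ eq)

  ⟪⟫-+₃ : ∀ (p : Poly n) f g k → ⟪ p , (λ w → f w + g w + k w) ⟫ ≡ ⟪ p , f ⟫ + ⟪ p , g ⟫ + ⟪ p , k ⟫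
  ⟪⟫-+₃ p f g k = trans (⟪⟫-+ p (λ w → f w + g w) k) (cong (_+ ⟪ p , k ⟫) (⟪⟫-+ p f g))

  ⟪⟫-+₃² : ∀ (p r : Poly n) (F G K : Word n → Word n → ℚ) →
    ⟪ p , (λ a → ⟪ r , (λ b → F a b + G a b + K a b) ⟫) ⟫
    ≡ ⟪ p , (λ a → ⟪ r , F a ⟫) ⟫ + ⟪ p , (λ a → ⟪ r , G a ⟫) ⟫ + ⟪ p , (λ a → ⟪ r , K a ⟫) ⟫
  ⟪⟫-+₃² p r F G K =
    trans (⟪⟫-cong p (λ a → ⟪⟫-+₃ r (F a) (G a) (K a)))
          (⟪⟫-+₃ p (λ a → ⟪ r , F a ⟫) (λ a → ⟪ r , G a ⟫) (λ a → ⟪ r , K a ⟫))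

  ⟪⟫-mono⊗lt⊕⊗lt : ∀ (u : Word n) d p c h →
    ⟪ mono u ⊗ lt d ⊕ p ⊗ lt c , h ⟫ ≡ h (u ∷ʳ d) + ⟪ p , h ∘ (_∷ʳ c) ⟫
  ⟪⟫-mono⊗lt⊕⊗lt u d p c h =
    trans (⟪⟫-⊕ (mono u ⊗ lt d) (p ⊗ lt c) h) (cong₂ _+_ (⟪⟫-mono⊗lt u d h) (⟪⟫-⊗lt p c h))

  ⟪⟫-mono⊗lt⊖⊗lt : ∀ (u : Word n) d p c h →
    ⟪ mono u ⊗ lt d ⊖ p ⊗ lt c , h ⟫ ≡ h (u ∷ʳ d) - ⟪ p , h ∘ (_∷ʳ c) ⟫
  ⟪⟫-mono⊗lt⊖⊗lt u d p c h =
    trans (⟪⟫-⊖ (mono u ⊗ lt d) (p ⊗ lt c) h) (cong₂ _-_ (⟪⟫-mono⊗lt u d h) (⟪⟫-⊗lt p c h))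

  ⟪⟫-[mono⊕mono]⊗lt : ∀ (u u′ : Word n) a h → ⟪ (mono u ⊕ mono u′) ⊗ lt a , h ⟫ ≡ h (u ∷ʳ a) + h (u′ ∷ʳ a)
  ⟪⟫-[mono⊕mono]⊗lt u u′ a h = trans (⟪⟫-⊗lt (mono u ⊕ mono u′) a h) (⟪⟫-mono⊕mono u u′ (h ∘ (_∷ʳ a)))

  indicator : Word n → Word n → ℚ
  indicator u w with word-≟ w u
  ... | yes _ = 1ℚ
  ... | no _  = 0ℚ

  coeff≡⟪⟫-indicator : ∀ (p : Poly n) u → coeff p u ≡ ⟪ p , indicator u ⟫
  coeff≡⟪⟫-indicator [] u = refl
  coeff≡⟪⟫-indicator ((c , w) ∷ p) u with word-≟ w u
  ... | yes _ = cong₂ _+_ (sym (ℚ.*-identityʳ c)) (coeff≡⟪⟫-indicator p u)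
  ... | no _  = trans (coeff≡⟪⟫-indicator p u)
                      (sym (trans (cong (_+ ⟪ p , indicator u ⟫) (ℚ.*-zeroʳ c)) (ℚ.+-identityˡ _)))

  ≈-by-⟪⟫ : ∀ {p q : Poly n} → (∀ h → ⟪ p , h ⟫ ≡ ⟪ q , h ⟫) → p ≈ q
  ≈-by-⟪⟫ {p} {q} eq u =
    trans (coeff≡⟪⟫-indicator p u) (trans (eq (indicator u)) (sym (coeff≡⟪⟫-indicator q u)))

reverse-∷-∷ʳ : ∀ {n} (c : Letter n) R d → reverse (c ∷ R) ∷ʳ d ≡ reverse R ++ c ∷ d ∷ []
reverse-∷-∷ʳ c R d = trans (cong (_∷ʳ d) (unfold-reverse c R)) (++-assoc (reverse R) (c ∷ []) (d ∷ []))

module _ {n : ℕ} where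

  κ : Letter n → Poly n
  κ 𝕩 = mono (𝕩 ∷ 𝕪₁ ∷ [])
  κ 𝕪₁ = ⊝ mono (𝕩 ∷ 𝕪₁ ∷ [])
  κ (𝕪 (suc k)) = mono (𝕪 (suc k) ∷ 𝕪₁ ∷ []) ⊖ (mono (𝕩 ∷ 𝕪 (suc k) ∷ []) ⊕ mono (𝕪 (suc k) ∷ 𝕪 (suc k) ∷ []))

  ⟪κ𝕪₁⟫ : ∀ g → ⟪ κ 𝕪₁ , g ⟫ ≡ - g (𝕩 ∷ 𝕪₁ ∷ [])
  ⟪κ𝕪₁⟫ g = trans (⟪⟫-scale (- 1ℚ) (mono (𝕩 ∷ 𝕪₁ ∷ [])) g)
                  (trans (cong ((- 1ℚ) *_) (⟪⟫-mono _ g)) (ring (g (𝕩 ∷ 𝕪₁ ∷ []))))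
    where
    ring : ∀ a → (- 1ℚ) * a ≡ - a
    ring = solve-∀ ℚring

  ⟪κ𝕪ₖ⟫ : ∀ k g → let yₖ = 𝕪 (suc k) in
    ⟪ κ yₖ , g ⟫ ≡ g (yₖ ∷ 𝕪₁ ∷ []) - (g (𝕩 ∷ yₖ ∷ []) + g (yₖ ∷ yₖ ∷ []))
  ⟪κ𝕪ₖ⟫ k g = trans (⟪⟫-⊖ (mono (yₖ ∷ 𝕪₁ ∷ [])) (mono (𝕩 ∷ yₖ ∷ []) ⊕ mono (yₖ ∷ yₖ ∷ [])) g)
                    (cong₂ _-_ (⟪⟫-mono (yₖ ∷ 𝕪₁ ∷ []) g) (⟪⟫-mono⊕mono (𝕩 ∷ yₖ ∷ []) (yₖ ∷ yₖ ∷ []) g))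
    where
    yₖ : Letter n
    yₖ = 𝕪 (suc k)

module _ {n : ℕ} (s : μ n) where
  open Diamond s

  -- Diamond stores words reversed: y⋄ʳ R is y ⋄_s (reverse R).
  y⋄ʳ x⋄ʳ : Word n → Poly n
  y⋄ʳ = dL Y []
  x⋄ʳ = dL X []

  y⋄ : Word n → Poly n
  y⋄ w = y⋄ʳ (reverse w)

  -- The left-hand sides of the two normalisations are what the pairings
  -- compute to; M_s and 𝓘 turn the root s into zero ·μ (s ·μ zero).
  ⟪y⋄[]⟫ : ∀ h → ⟪ y⋄ [] , h ⟫ ≡ h (𝕪₁ ∷ []) - δ s * h (𝕪 s ∷ [])
  ⟪y⋄[]⟫ h = trans (normalise (δ s′) (h (𝕪₁ ∷ [])) (h (𝕪 s′ ∷ [])))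
                   (cong (λ u → h (𝕪₁ ∷ []) - δ u * h (𝕪 u ∷ [])) (trans (·μ-identityˡ _) (·μ-identityʳ s)))
    where
    s′ : μ n
    s′ = zero ·μ (s ·μ zero)
    normalise : ∀ d a b → 0ℚ * (d * 1ℚ * 1ℚ) * b + (0ℚ * a + ((- 1ℚ) * (d * 1ℚ * 1ℚ) * b + (1ℚ * a + 0ℚ)))
                          ≡ a - d * b
    normalise = solve-∀ ℚring

  ⟪x⋄[]⟫ : ∀ h → ⟪ x⋄ʳ [] , h ⟫ ≡ h (𝕩 ∷ []) + δ s * h (𝕪 s ∷ [])
  ⟪x⋄[]⟫ h = trans (normalise (δ s′) (h (𝕩 ∷ [])) (h (𝕪₁ ∷ [])) (h (𝕪 s′ ∷ [])))
                   (cong (λ u → h (𝕩 ∷ []) + δ u * h (𝕪 u ∷ [])) (trans (·μ-identityˡ _) (·μ-identityʳ s)))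
    where
    s′ : μ n
    s′ = zero ·μ (s ·μ zero)
    normalise : ∀ d x a b → 1ℚ * x + (1ℚ * a + (1ℚ * (d * 1ℚ * 1ℚ) * b + ((- 1ℚ) * a + 0ℚ)))
                            ≡ x + d * b
    normalise = solve-∀ ℚring

  y⋄ʳ-𝕪ₖ∷ : ∀ k R h → let yₖ = 𝕪 (suc k) in
    ⟪ y⋄ʳ (yₖ ∷ R) , h ⟫
    ≡ h (reverse (yₖ ∷ R) ∷ʳ 𝕪₁) - (h (reverse (𝕩 ∷ R) ∷ʳ yₖ) + h (reverse (yₖ ∷ R) ∷ʳ yₖ))
      + ⟪ y⋄ʳ R , h ∘ (_∷ʳ yₖ) ⟫
  y⋄ʳ-𝕪ₖ∷ k R h =
    trans (⟪⟫-⊕ (A ⊖ B) (y⋄ʳ R ⊗ lt yₖ) h)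
          (cong₂ _+_ (trans (⟪⟫-⊖ A B h) (cong₂ _-_ (⟪⟫-mono⊗lt V 𝕪₁ h) (⟪⟫-[mono⊕mono]⊗lt V′ V yₖ h)))
                     (⟪⟫-⊗lt (y⋄ʳ R) yₖ h))
    where
    yₖ : Letter n
    yₖ = 𝕪 (suc k)
    V V′ : Word n
    V = reverse (yₖ ∷ R)
    V′ = reverse (𝕩 ∷ R)
    A B : Poly n
    A = mono V ⊗ lt 𝕪₁
    B = (mono V′ ⊕ mono V) ⊗ lt yₖ

  x⋄ʳ-𝕪ₖ∷ : ∀ k R h → let yₖ = 𝕪 (suc k) in
    ⟪ x⋄ʳ (yₖ ∷ R) , h ⟫
    ≡ h (reverse (yₖ ∷ R) ∷ʳ 𝕩) + (h (reverse (𝕩 ∷ R) ∷ʳ yₖ) + h (reverse (yₖ ∷ R) ∷ʳ yₖ))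
      - ⟪ y⋄ʳ R , h ∘ (_∷ʳ yₖ) ⟫
  x⋄ʳ-𝕪ₖ∷ k R h =
    trans (⟪⟫-⊖ (A ⊕ B) (y⋄ʳ R ⊗ lt yₖ) h)
          (cong₂ _-_ (trans (⟪⟫-⊕ A B h) (cong₂ _+_ (⟪⟫-mono⊗lt V 𝕩 h) (⟪⟫-[mono⊕mono]⊗lt V′ V yₖ h)))
                     (⟪⟫-⊗lt (y⋄ʳ R) yₖ h))
    where
    yₖ : Letter n
    yₖ = 𝕪 (suc k)
    V V′ : Word n
    V = reverse (yₖ ∷ R)
    V′ = reverse (𝕩 ∷ R)
    A B : Poly n
    A = mono V ⊗ lt 𝕩
    B = (mono V′ ⊕ mono V) ⊗ lt yₖ

  x⋄ʳ-by-y⋄ʳ : ∀ R h → ⟪ x⋄ʳ R , h ⟫ ≡ h (reverse R ∷ʳ 𝕩) + h (reverse R ∷ʳ 𝕪₁) - ⟪ y⋄ʳ R , h ⟫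
  x⋄ʳ-by-y⋄ʳ [] h =
    trans (⟪x⋄[]⟫ h) (trans (ring (h (𝕩 ∷ [])) (h (𝕪₁ ∷ [])) (δ s) (h (𝕪 s ∷ [])))
                            (cong (_-_ (h (𝕩 ∷ []) + h (𝕪₁ ∷ []))) (sym (⟪y⋄[]⟫ h))))
    where
    ring : ∀ x a d b → x + d * b ≡ x + a - (a - d * b)
    ring = solve-∀ ℚring
  x⋄ʳ-by-y⋄ʳ (𝕩 ∷ R) h =
    trans (⟪⟫-mono⊗lt⊖⊗lt V 𝕩 (y⋄ʳ R) 𝕩 h)
          (trans (ring (h (V ∷ʳ 𝕩)) (h (V ∷ʳ 𝕪₁)) _)
                 (cong (_-_ (h (V ∷ʳ 𝕩) + h (V ∷ʳ 𝕪₁))) (sym (⟪⟫-mono⊗lt⊕⊗lt V 𝕪₁ (y⋄ʳ R) 𝕩 h))))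
    where
    V : Word n
    V = reverse (𝕩 ∷ R)
    ring : ∀ a b p → a - p ≡ a + b - (b + p)
    ring = solve-∀ ℚring
  x⋄ʳ-by-y⋄ʳ (𝕪₁ ∷ R) h =
    trans (⟪⟫-mono⊗lt⊕⊗lt V 𝕩 (x⋄ʳ R) 𝕪₁ h)
          (trans (ring (h (V ∷ʳ 𝕩)) (h (V ∷ʳ 𝕪₁)) _)
                 (cong (_-_ (h (V ∷ʳ 𝕩) + h (V ∷ʳ 𝕪₁))) (sym (⟪⟫-mono⊗lt⊖⊗lt V 𝕪₁ (x⋄ʳ R) 𝕪₁ h))))
    where
    V : Word n
    V = reverse (𝕪₁ ∷ R)
    ring : ∀ a b p → a + p ≡ a + b - (b - p)
    ring = solve-∀ ℚring
  x⋄ʳ-by-y⋄ʳ (𝕪 (suc k) ∷ R) h =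
    trans (x⋄ʳ-𝕪ₖ∷ k R h)
          (trans (ring (h (V ∷ʳ 𝕩)) (h (V ∷ʳ 𝕪₁)) _ _)
                 (cong (_-_ (h (V ∷ʳ 𝕩) + h (V ∷ʳ 𝕪₁))) (sym (y⋄ʳ-𝕪ₖ∷ k R h))))
    where
    V : Word n
    V = reverse (𝕪 (suc k) ∷ R)
    ring : ∀ a b e p → a + e - p ≡ a + b - (b - e + p)
    ring = solve-∀ ℚring

  y⋄ʳ-∷ : ∀ c R h → ⟪ y⋄ʳ (c ∷ R) , h ⟫ ≡ ⟪ y⋄ʳ R , h ∘ (_∷ʳ c) ⟫ + ⟪ κ c , h ∘ (reverse R ++_) ⟫
  y⋄ʳ-∷ 𝕩 R h = begin
    ⟪ y⋄ʳ (𝕩 ∷ R) , h ⟫                  ≡⟨ ⟪⟫-mono⊗lt⊕⊗lt (reverse (𝕩 ∷ R)) 𝕪₁ (y⋄ʳ R) 𝕩 h ⟩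
    h (reverse (𝕩 ∷ R) ∷ʳ 𝕪₁) + P        ≡⟨ cong (λ u → h u + P) (reverse-∷-∷ʳ 𝕩 R 𝕪₁) ⟩
    h (W ++ 𝕩 ∷ 𝕪₁ ∷ []) + P             ≡⟨ ℚ.+-comm _ P ⟩
    P + h (W ++ 𝕩 ∷ 𝕪₁ ∷ [])             ≡⟨ cong (P +_) (sym (⟪⟫-mono _ (h ∘ (W ++_)))) ⟩
    P + ⟪ κ 𝕩 , h ∘ (W ++_) ⟫            ∎
    where
    W : Word n
    W = reverse R
    P : ℚ
    P = ⟪ y⋄ʳ R , h ∘ (_∷ʳ 𝕩) ⟫
  y⋄ʳ-∷ 𝕪₁ R h = begin
    ⟪ y⋄ʳ (𝕪₁ ∷ R) , h ⟫
      ≡⟨ ⟪⟫-mono⊗lt⊖⊗lt (reverse (𝕪₁ ∷ R)) 𝕪₁ (x⋄ʳ R) 𝕪₁ h ⟩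
    h (reverse (𝕪₁ ∷ R) ∷ʳ 𝕪₁) - ⟪ x⋄ʳ R , h′ ⟫
      ≡⟨ cong (_-_ (h (reverse (𝕪₁ ∷ R) ∷ʳ 𝕪₁))) (x⋄ʳ-by-y⋄ʳ R h′) ⟩
    h (reverse (𝕪₁ ∷ R) ∷ʳ 𝕪₁) - (h′ (W ∷ʳ 𝕩) + h′ (W ∷ʳ 𝕪₁) - P)
      ≡⟨ cong₂ (λ a b → a - (b + h′ (W ∷ʳ 𝕪₁) - P))
               (cong h (reverse-∷-∷ʳ 𝕪₁ R 𝕪₁)) (cong h (++-assoc W (𝕩 ∷ []) (𝕪₁ ∷ []))) ⟩
    h (W ++ 𝕪₁ ∷ 𝕪₁ ∷ []) - (h (W ++ 𝕩 ∷ 𝕪₁ ∷ []) + h′ (W ∷ʳ 𝕪₁) - P)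
      ≡⟨ cong (λ a → h (W ++ 𝕪₁ ∷ 𝕪₁ ∷ []) - (h (W ++ 𝕩 ∷ 𝕪₁ ∷ []) + h a - P))
              (++-assoc W (𝕪₁ ∷ []) (𝕪₁ ∷ [])) ⟩
    h (W ++ 𝕪₁ ∷ 𝕪₁ ∷ []) - (h (W ++ 𝕩 ∷ 𝕪₁ ∷ []) + h (W ++ 𝕪₁ ∷ 𝕪₁ ∷ []) - P)
      ≡⟨ ring (h (W ++ 𝕪₁ ∷ 𝕪₁ ∷ [])) (h (W ++ 𝕩 ∷ 𝕪₁ ∷ [])) P ⟩
    P + - h (W ++ 𝕩 ∷ 𝕪₁ ∷ [])
      ≡⟨ cong (P +_) (sym (⟪κ𝕪₁⟫ (h ∘ (W ++_)))) ⟩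
    P + ⟪ κ 𝕪₁ , h ∘ (W ++_) ⟫ ∎
    where
    W : Word n
    W = reverse R
    h′ : Word n → ℚ
    h′ = h ∘ (_∷ʳ 𝕪₁)
    P : ℚ
    P = ⟪ y⋄ʳ R , h′ ⟫
    ring : ∀ b a p → b - (a + b - p) ≡ p + - a
    ring = solve-∀ ℚring
  y⋄ʳ-∷ (𝕪 (suc k)) R h = begin
    ⟪ y⋄ʳ (yₖ ∷ R) , h ⟫
      ≡⟨ y⋄ʳ-𝕪ₖ∷ k R h ⟩
    h (reverse (yₖ ∷ R) ∷ʳ 𝕪₁) - (h (reverse (𝕩 ∷ R) ∷ʳ yₖ) + h (reverse (yₖ ∷ R) ∷ʳ yₖ)) + P
      ≡⟨ cong₂ (λ a b → a - b + P) (cong h (reverse-∷-∷ʳ yₖ R 𝕪₁))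
               (cong₂ _+_ (cong h (reverse-∷-∷ʳ 𝕩 R yₖ)) (cong h (reverse-∷-∷ʳ yₖ R yₖ))) ⟩
    g (yₖ ∷ 𝕪₁ ∷ []) - (g (𝕩 ∷ yₖ ∷ []) + g (yₖ ∷ yₖ ∷ [])) + P
      ≡⟨ ℚ.+-comm _ P ⟩
    P + (g (yₖ ∷ 𝕪₁ ∷ []) - (g (𝕩 ∷ yₖ ∷ []) + g (yₖ ∷ yₖ ∷ [])))
      ≡⟨ cong (P +_) (sym (⟪κ𝕪ₖ⟫ k g)) ⟩
    P + ⟪ κ yₖ , g ⟫ ∎
    where
    yₖ : Letter n
    yₖ = 𝕪 (suc k)
    g : Word n → ℚ
    g = h ∘ (reverse R ++_)
    P : ℚ
    P = ⟪ y⋄ʳ R , h ∘ (_∷ʳ yₖ) ⟫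

  y⋄-∷ʳ : ∀ w c h → ⟪ y⋄ (w ∷ʳ c) , h ⟫ ≡ ⟪ y⋄ w , h ∘ (_∷ʳ c) ⟫ + ⟪ κ c , h ∘ (w ++_) ⟫
  y⋄-∷ʳ w c h = begin
    ⟪ y⋄ʳ (reverse (w ∷ʳ c)) , h ⟫
      ≡⟨ cong (λ R → ⟪ y⋄ʳ R , h ⟫) (reverse-++ w (c ∷ [])) ⟩
    ⟪ y⋄ʳ (c ∷ reverse w) , h ⟫
      ≡⟨ y⋄ʳ-∷ c (reverse w) h ⟩
    ⟪ y⋄ w , h ∘ (_∷ʳ c) ⟫ + ⟪ κ c , h ∘ (reverse (reverse w) ++_) ⟫
      ≡⟨ cong (λ u → ⟪ y⋄ w , h ∘ (_∷ʳ c) ⟫ + ⟪ κ c , h ∘ (u ++_) ⟫) (reverse-involutive w) ⟩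
    ⟪ y⋄ w , h ∘ (_∷ʳ c) ⟫ + ⟪ κ c , h ∘ (w ++_) ⟫ ∎

  y⋄-++ : ∀ p q h →
    ⟪ y⋄ (p ++ q) , h ⟫
    ≡ ⟪ y⋄ p , (λ u → h (u ++ q)) ⟫ + ⟪ y⋄ q , (λ u → h (p ++ u)) ⟫ - ⟪ y⋄ [] , (λ u → h (p ++ u ++ q)) ⟫
  y⋄-++ p q = go (reverseView q)
    where
    go : ∀ {q} → Reverse q → ∀ h →
      ⟪ y⋄ (p ++ q) , h ⟫
      ≡ ⟪ y⋄ p , (λ u → h (u ++ q)) ⟫ + ⟪ y⋄ q , (λ u → h (p ++ u)) ⟫ - ⟪ y⋄ [] , (λ u → h (p ++ u ++ q)) ⟫
    go [] h = begin
      ⟪ y⋄ (p ++ []) , h ⟫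
        ≡⟨ cong (λ w → ⟪ y⋄ w , h ⟫) (++-identityʳ p) ⟩
      ⟪ y⋄ p , h ⟫
        ≡⟨ ⟪⟫-cong∘ (y⋄ p) h (λ u → sym (++-identityʳ u)) ⟩
      A
        ≡⟨ ring A B ⟩
      A + B - B
        ≡⟨ cong (_-_ (A + B)) (⟪⟫-cong∘ (y⋄ []) h (λ u → cong (p ++_) (sym (++-identityʳ u)))) ⟩
      A + B - ⟪ y⋄ [] , (λ u → h (p ++ u ++ [])) ⟫ ∎
      where
      A B : ℚ
      A = ⟪ y⋄ p , (λ u → h (u ++ [])) ⟫
      B = ⟪ y⋄ [] , (λ u → h (p ++ u)) ⟫
      ring : ∀ a b → a ≡ a + b - b
      ring = solve-∀ ℚring
    go (q ∶ rs ∶ʳ c) h = begin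
      ⟪ y⋄ (p ++ q ∷ʳ c) , h ⟫
        ≡⟨ cong (λ w → ⟪ y⋄ w , h ⟫) (sym (++-assoc p q (c ∷ []))) ⟩
      ⟪ y⋄ ((p ++ q) ∷ʳ c) , h ⟫
        ≡⟨ y⋄-∷ʳ (p ++ q) c h ⟩
      ⟪ y⋄ (p ++ q) , h ∘ (_∷ʳ c) ⟫ + ⟪ κ c , h ∘ ((p ++ q) ++_) ⟫
        ≡⟨ cong₂ _+_ (go rs (h ∘ (_∷ʳ c))) (⟪⟫-cong∘ (κ c) h (++-assoc p q)) ⟩
      ⟪ y⋄ p , (λ u → h ((u ++ q) ∷ʳ c)) ⟫ + ⟪ y⋄ q , (λ u → h ((p ++ u) ∷ʳ c)) ⟫
        - ⟪ y⋄ [] , (λ u → h ((p ++ u ++ q) ∷ʳ c)) ⟫ + K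
        ≡⟨ cong₂ (λ a b → a - b + K)
                 (cong₂ _+_ (⟪⟫-cong∘ (y⋄ p) h (λ u → ++-assoc u q (c ∷ [])))
                            (⟪⟫-cong∘ (y⋄ q) h (λ u → ++-assoc p u (c ∷ []))))
                 (⟪⟫-cong∘ (y⋄ []) h (λ u → trans (++-assoc p (u ++ q) (c ∷ []))
                                                  (cong (p ++_) (++-assoc u q (c ∷ []))))) ⟩
      A + B - C + K
        ≡⟨ ring A B C K ⟩
      A + (B + K) - C
        ≡⟨ cong (λ X → A + X - C) (sym (y⋄-∷ʳ q c (h ∘ (p ++_)))) ⟩
      A + ⟪ y⋄ (q ∷ʳ c) , h ∘ (p ++_) ⟫ - C ∎
      where
      A B C K : ℚ
      A = ⟪ y⋄ p , (λ u → h (u ++ q ∷ʳ c)) ⟫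
      B = ⟪ y⋄ q , (λ u → h (p ++ u ∷ʳ c)) ⟫
      C = ⟪ y⋄ [] , (λ u → h (p ++ u ++ q ∷ʳ c)) ⟫
      K = ⟪ κ c , (λ u → h (p ++ q ++ u)) ⟫
      ring : ∀ a b c k → a + b - c + k ≡ a + (b + k) - c
      ring = solve-∀ ℚring

  ε : Letter n → Poly n
  ε c = κ c ⊖ lt c ⊗ y⋄ []

  ⟪ε⟫ : ∀ c g → ⟪ ε c , g ⟫ ≡ ⟪ κ c , g ⟫ - ⟪ y⋄ [] , g ∘ (c ∷_) ⟫
  ⟪ε⟫ c g = trans (⟪⟫-⊖ (κ c) (lt c ⊗ y⋄ []) g) (cong (_-_ ⟪ κ c , g ⟫) (⟪⟫-lt⊗ c (y⋄ []) g))

  y⋄-insert : ∀ a c b h →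
    ⟪ y⋄ (a ++ c ∷ b) , h ⟫
    ≡ ⟪ y⋄ a , (λ u → h (u ++ c ∷ b)) ⟫ + ⟪ y⋄ b , (λ u → h (a ++ c ∷ u)) ⟫
      + ⟪ ε c , (λ u → h (a ++ u ++ b)) ⟫
  y⋄-insert a c b h = begin
    ⟪ y⋄ (a ++ c ∷ b) , h ⟫
      ≡⟨ cong (λ w → ⟪ y⋄ w , h ⟫) (sym (++-assoc a (c ∷ []) b)) ⟩
    ⟪ y⋄ ((a ∷ʳ c) ++ b) , h ⟫
      ≡⟨ y⋄-++ (a ∷ʳ c) b h ⟩
    ⟪ y⋄ (a ∷ʳ c) , (λ u → h (u ++ b)) ⟫ + ⟪ y⋄ b , (λ u → h ((a ∷ʳ c) ++ u)) ⟫
      - ⟪ y⋄ [] , (λ u → h ((a ∷ʳ c) ++ u ++ b)) ⟫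
      ≡⟨ cong (λ X → X + ⟪ y⋄ b , (λ u → h ((a ∷ʳ c) ++ u)) ⟫ - ⟪ y⋄ [] , (λ u → h ((a ∷ʳ c) ++ u ++ b)) ⟫)
              (y⋄-∷ʳ a c (λ u → h (u ++ b))) ⟩
    ⟪ y⋄ a , (λ u → h ((u ∷ʳ c) ++ b)) ⟫ + ⟪ κ c , (λ u → h ((a ++ u) ++ b)) ⟫
      + ⟪ y⋄ b , (λ u → h ((a ∷ʳ c) ++ u)) ⟫ - ⟪ y⋄ [] , (λ u → h ((a ∷ʳ c) ++ u ++ b)) ⟫
      ≡⟨ cong₂ _-_
               (cong₂ _+_ (cong₂ _+_ (⟪⟫-cong∘ (y⋄ a) h (λ u → ++-assoc u (c ∷ []) b))
                                     (⟪⟫-cong∘ (κ c) h (λ u → ++-assoc a u b)))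
                          (⟪⟫-cong∘ (y⋄ b) h (++-assoc a (c ∷ []))))
               (⟪⟫-cong∘ (y⋄ []) h (λ u → ++-assoc a (c ∷ []) (u ++ b))) ⟩
    A + K + B - C
      ≡⟨ ring A K B C ⟩
    A + B + (K - C)
      ≡⟨ cong (A + B +_) (sym (⟪ε⟫ c g)) ⟩
    A + B + ⟪ ε c , g ⟫ ∎
    where
    g : Word n → ℚ
    g u = h (a ++ u ++ b)
    A B C K : ℚ
    A = ⟪ y⋄ a , (λ u → h (u ++ c ∷ b)) ⟫
    B = ⟪ y⋄ b , (λ u → h (a ++ c ∷ u)) ⟫
    C = ⟪ y⋄ [] , (λ u → h (a ++ c ∷ u ++ b)) ⟫
    K = ⟪ κ c , g ⟫
    ring : ∀ a k b c → a + k + b - c ≡ a + b + (k - c)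
    ring = solve-∀ ℚring

  ε-zδ : ∀ t g → ⟪ ε 𝕩 , g ⟫ + δ t * ⟪ ε (𝕪 t) , g ⟫ ≡ ⟪ zδ t ⊗ (zδ s ⊖ zδ t) , g ⟫
  ε-zδ t g = begin
    ⟪ ε 𝕩 , g ⟫ + δ t * ⟪ ε (𝕪 t) , g ⟫
      ≡⟨ cong₂ (λ a b → a + δ t * b) (⟪ε⟫′ 𝕩) (⟪ε⟫′ (𝕪 t)) ⟩
    E 𝕩 + δ t * E (𝕪 t)
      ≡⟨ balance t ⟩
    F t 𝕩 + δ t * F t (𝕪 t)
      ≡⟨ sym (cong₂ (λ a b → a + δ t * b) (F-eq 𝕩) (F-eq (𝕪 t))) ⟩
    ⟪ zδ s ⊖ zδ t , g ∘ (𝕩 ∷_) ⟫ + δ t * ⟪ zδ s ⊖ zδ t , g ∘ (𝕪 t ∷_) ⟫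
      ≡⟨ sym (trans (⟪⟫-⊗ (zδ t) (zδ s ⊖ zδ t) g) (⟪⟫-zδ t (λ m → ⟪ zδ s ⊖ zδ t , g ∘ (m ++_) ⟫))) ⟩
    ⟪ zδ t ⊗ (zδ s ⊖ zδ t) , g ⟫ ∎
    where
    E : Letter n → ℚ
    E c = ⟪ κ c , g ⟫ - (g (c ∷ 𝕪₁ ∷ []) - δ s * g (c ∷ 𝕪 s ∷ []))

    F : μ n → Letter n → ℚ
    F t′ c = g (c ∷ 𝕩 ∷ []) + δ s * g (c ∷ 𝕪 s ∷ []) - (g (c ∷ 𝕩 ∷ []) + δ t′ * g (c ∷ 𝕪 t′ ∷ []))

    ⟪ε⟫′ : ∀ c → ⟪ ε c , g ⟫ ≡ E c
    ⟪ε⟫′ c = trans (⟪ε⟫ c g) (cong (_-_ ⟪ κ c , g ⟫) (⟪y⋄[]⟫ (g ∘ (c ∷_))))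

    F-eq : ∀ c → ⟪ zδ s ⊖ zδ t , g ∘ (c ∷_) ⟫ ≡ F t c
    F-eq c = trans (⟪⟫-⊖ (zδ s) (zδ t) (g ∘ (c ∷_))) (cong₂ _-_ (⟪⟫-zδ s (g ∘ (c ∷_))) (⟪⟫-zδ t (g ∘ (c ∷_))))

    balance : ∀ t′ → E 𝕩 + δ t′ * E (𝕪 t′) ≡ F t′ 𝕩 + δ t′ * F t′ (𝕪 t′)
    balance zero =
      trans (cong (λ a → a - (g (𝕩 ∷ 𝕪₁ ∷ []) - δ s * g (𝕩 ∷ 𝕪 s ∷ [])) + 0ℚ * E 𝕪₁) (⟪⟫-mono _ g))
            (ring (g (𝕩 ∷ 𝕪₁ ∷ [])) (g (𝕩 ∷ 𝕪 s ∷ [])) (δ s) (E 𝕪₁) (g (𝕩 ∷ 𝕩 ∷ [])) (F zero 𝕪₁))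
      where
      ring : ∀ a b d e x f → a - (a - d * b) + 0ℚ * e ≡ x + d * b - (x + 0ℚ * a) + 0ℚ * f
      ring = solve-∀ ℚring
    balance (suc k) =
      trans (cong₂ (λ a b → a - (g (𝕩 ∷ 𝕪₁ ∷ []) - δ s * g (𝕩 ∷ 𝕪 s ∷ []))
                            + 1ℚ * (b - (g (yₖ ∷ 𝕪₁ ∷ []) - δ s * g (yₖ ∷ 𝕪 s ∷ []))))
                   (⟪⟫-mono _ g) (⟪κ𝕪ₖ⟫ k g))
            (ring (g (𝕩 ∷ 𝕪₁ ∷ [])) (g (𝕩 ∷ 𝕪 s ∷ [])) (δ s) (g (yₖ ∷ 𝕪₁ ∷ [])) (g (𝕩 ∷ yₖ ∷ []))
                  (g (yₖ ∷ yₖ ∷ [])) (g (yₖ ∷ 𝕪 s ∷ [])) (g (𝕩 ∷ 𝕩 ∷ [])) (g (yₖ ∷ 𝕩 ∷ [])))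
      where
      yₖ : Letter n
      yₖ = 𝕪 (suc k)
      ring : ∀ a b d p q r c x z →
        a - (a - d * b) + 1ℚ * (p - (q + r) - (p - d * c))
        ≡ x + d * b - (x + 1ℚ * q) + 1ℚ * (z + d * c - (z + 1ℚ * r))
      ring = solve-∀ ℚring

  y⋄-around-zδ : ∀ t a b h →
    ⟪ zδ t , (λ m → ⟪ y⋄ (a ++ m ++ b) , h ⟫) ⟫
    ≡ ⟪ zδ t , (λ m → ⟪ y⋄ a , (λ u → h (u ++ m ++ b)) ⟫) ⟫
      + ⟪ zδ t , (λ m → ⟪ y⋄ b , (λ u → h (a ++ m ++ u)) ⟫) ⟫
      + ⟪ zδ t ⊗ (zδ s ⊖ zδ t) , (λ m → h (a ++ m ++ b)) ⟫
  y⋄-around-zδ t a b h = begin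
    ⟪ zδ t , L ⟫
      ≡⟨ ⟪⟫-zδ t L ⟩
    L (𝕩 ∷ []) + δ t * L (𝕪 t ∷ [])
      ≡⟨ cong₂ (λ p q → p + δ t * q) (y⋄-insert a 𝕩 b h) (y⋄-insert a (𝕪 t) b h) ⟩
    T₁ (𝕩 ∷ []) + T₂ (𝕩 ∷ []) + D 𝕩 + δ t * (T₁ (𝕪 t ∷ []) + T₂ (𝕪 t ∷ []) + D (𝕪 t))
      ≡⟨ ring (T₁ (𝕩 ∷ [])) (T₂ (𝕩 ∷ [])) (D 𝕩) (T₁ (𝕪 t ∷ [])) (T₂ (𝕪 t ∷ [])) (D (𝕪 t)) (δ t) ⟩
    (T₁ (𝕩 ∷ []) + δ t * T₁ (𝕪 t ∷ [])) + (T₂ (𝕩 ∷ []) + δ t * T₂ (𝕪 t ∷ [])) + (D 𝕩 + δ t * D (𝕪 t))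
      ≡⟨ cong₂ _+_ (cong₂ _+_ (sym (⟪⟫-zδ t T₁)) (sym (⟪⟫-zδ t T₂))) (ε-zδ t g) ⟩
    ⟪ zδ t , T₁ ⟫ + ⟪ zδ t , T₂ ⟫ + ⟪ zδ t ⊗ (zδ s ⊖ zδ t) , g ⟫ ∎
    where
    L T₁ T₂ g : Word n → ℚ
    L m = ⟪ y⋄ (a ++ m ++ b) , h ⟫
    T₁ m = ⟪ y⋄ a , (λ u → h (u ++ m ++ b)) ⟫
    T₂ m = ⟪ y⋄ b , (λ u → h (a ++ m ++ u)) ⟫
    g m = h (a ++ m ++ b)
    D : Letter n → ℚ
    D c = ⟪ ε c , g ⟫
    ring : ∀ p₁ p₂ p₃ q₁ q₂ q₃ d →
      p₁ + p₂ + p₃ + d * (q₁ + q₂ + q₃) ≡ (p₁ + d * q₁) + (p₂ + d * q₂) + (p₃ + d * q₃)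
    ring = solve-∀ ℚring

lemma5p6 : (n : ℕ) (s t : μ n) (v w : Poly n) →
    (Y ∷ []) ⋄[ s ] (v ⊗ zδ t ⊗ w)
      ≈ ((Y ∷ []) ⋄[ s ] v) ⊗ zδ t ⊗ w
        ⊕ v ⊗ zδ t ⊗ ((Y ∷ []) ⋄[ s ] w)
        ⊕ v ⊗ zδ t ⊗ (zδ s ⊖ zδ t) ⊗ w
lemma5p6 n s t v w =
  ≈-by-⟪⟫ {p = y⋄* (v ⊗ zₜ ⊗ w)} {q = y⋄* v ⊗ zₜ ⊗ w ⊕ v ⊗ zₜ ⊗ y⋄* w ⊕ v ⊗ zₜ ⊗ Δ ⊗ w} λ h → begin
    ⟪ y⋄* (v ⊗ zₜ ⊗ w) , h ⟫
      ≡⟨ ⟪⟫-linext-sandwich (y⋄ s) v zₜ w h ⟩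
    ⟪ v , (λ a → ⟪ w , (λ b → ⟪ zₜ , (λ m → ⟪ y⋄ s (a ++ m ++ b) , h ⟫) ⟫) ⟫) ⟫
      ≡⟨ ⟪⟫-cong v (λ a → ⟪⟫-cong w (λ b → y⋄-around-zδ s t a b h)) ⟩
    _ ≡⟨ ⟪⟫-+₃² v w _ _ _ ⟩
    _ ≡⟨ sym (cong₂ _+_ (cong₂ _+_ (⟪⟫-linext⊗⊗ (y⋄ s) v zₜ w h) (⟪⟫-⊗⊗linext (y⋄ s) v zₜ w h))
                        (⟪⟫-⊗⊗⊗ v zₜ Δ w h)) ⟩
    ⟪ y⋄* v ⊗ zₜ ⊗ w , h ⟫ + ⟪ v ⊗ zₜ ⊗ y⋄* w , h ⟫ + ⟪ v ⊗ zₜ ⊗ Δ ⊗ w , h ⟫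
      ≡⟨ sym (⟪⟫-⊕₃ (y⋄* v ⊗ zₜ ⊗ w) (v ⊗ zₜ ⊗ y⋄* w) (v ⊗ zₜ ⊗ Δ ⊗ w) h) ⟩
    ⟪ y⋄* v ⊗ zₜ ⊗ w ⊕ v ⊗ zₜ ⊗ y⋄* w ⊕ v ⊗ zₜ ⊗ Δ ⊗ w , h ⟫ ∎
  where
  zₜ Δ : Poly n
  zₜ = zδ t
  Δ = zδ s ⊖ zδ t

  y⋄* : Poly n → Poly n
  y⋄* p = (Y ∷ []) ⋄[ s ] p
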